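{- Let $G$ be a graph on $n$ vertices that is not a permutation graph. Then every $12$-representant of (any labeling of) $G$ has length at least $n+1$.
   Context: A labeled graph on $n$ vertices has its vertices labeled by distinct integers from $[n]=\{1,\dots,n\}$; vertices are identified with their labels. A word $w$ over $[n]$ is a $12$-representant of the labeled graph $G$ if every letter of $[n]$ occurs at least once in $w$ and, for all $i<j$, the vertices $i$ and $j$ are adjacent in $G$ if and only if there is no occurrence of $i$ in $w$ that precedes an occurrence of $j$. A $12$-representant of an unlabeled graph is a $12$-representant of some labeling of it. -}

module Defs where

open import Level using (0ℓ)
open import Data.Nat using (ℕ)
open import Data.Fin using (Fin; _<_)
open import Data.List using (List; _++_)
open import Data.List.Membership.Propositional using (_∈_)
open import Data.Product using (Σ; ∃; ∃-syntax; _×_)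
open import Relation.Binary.PropositionalEquality using (_≡_)
open import Relation.Nullary using (¬_)
open import Function.Bundles using (_↔_; _⇔_; Inverse)

record Graph (n : ℕ) : Set₁ where
  field
    Adj    : Fin n → Fin n → Set
    sym    : ∀ {u v} → Adj u v → Adj v u
    irrefl : ∀ {u} → ¬ Adj u u
open Graph public

-- A labeled graph: vertices are identified with their labels in Fin n
-- (Fin n stands for [n], with the order of Fin).  We only need its
-- adjacency relation on labels.
LabeledAdj : ℕ → Set₁
LabeledAdj n = Fin n → Fin n → Set

labeled : ∀ {n} → Graph n → (Fin n ↔ Fin n) → LabeledAdj n
labeled G σ i j = Adj G (Inverse.from σ i) (Inverse.from σ j)

Precedes : ∀ {n} → List (Fin n) → Fin n → Fin n → Set
Precedes w i j = ∃[ xs ] ∃[ ys ] (w ≡ xs ++ ys × i ∈ xs × j ∈ ys)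

Is12Representant : ∀ {n} → LabeledAdj n → List (Fin n) → Set
Is12Representant {n} H w =
  (∀ (i : Fin n) → i ∈ w) ×
  (∀ (i j : Fin n) → i < j → (H i j ⇔ (¬ Precedes w i j)))

InversionAdj : ∀ {n} → (Fin n ↔ Fin n) → Fin n → Fin n → Set
InversionAdj π i j =
  (i < j × Inverse.to π j < Inverse.to π i) Data.Sum.⊎
  (j < i × Inverse.to π i < Inverse.to π j)
  where import Data.Sum

IsPermutationGraph : ∀ {n} → Graph n → Set
IsPermutationGraph {n} G =
  Σ (Fin n ↔ Fin n) λ φ → Σ (Fin n ↔ Fin n) λ π → (∀ (u v : Fin n) →
    (Adj G u v ⇔ InversionAdj π (Inverse.to φ u) (Inverse.to φ v)))

-- If a word w contains every letter of [n] and has length at most n, it is a permutation of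
-- [n], so each letter has a unique position in w and "i precedes j" just compares positions.
-- For i < j, adjacency of i and j then means that j comes before i in w: the labeled graph is
-- the inversion graph of the positions, and G, isomorphic to it via the labeling, would be a
-- permutation graph.
module Submission where

open import Defs
open import Data.Nat using (ℕ; suc; _≤_)
open import Data.Fin using (Fin)
open import Data.List using (List; length)
open import Relation.Nullary using (¬_)
open import Function.Bundles using (_↔_)

import Data.Nat as ℕ
import Data.Nat.Properties as ℕ
open import Data.Fin using (toℕ; cast; punchOut; _<_; _≟_)
open import Data.Fin.Properties
  using (toℕ-cast; cast-involutive; punchOut-injective; injective⇒≤; any?; <-cmp; <⇒≢; <-asym)
open import Data.List using ([]; _∷_; _++_; lookup)
open import Data.List.Membership.Propositional using (_∈_)
open import Data.List.Membership.Propositional.Properties using (∈-++⁺ˡ; ∈-++⁺ʳ)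
open import Data.List.Relation.Unary.Any using (here; there; index)
open import Data.List.Relation.Unary.Any.Properties using (lookup-index)
open import Data.Product using (∃; ∃₂; _×_; _,_)
open import Data.Sum using (inj₁; inj₂)
open import Function.Base using (_∘_)
open import Function.Bundles using (Inverse; Injection; mk↔ₛ′; _⇔_; mk⇔; Equivalence)
open import Function.Definitions using (Injective)
open import Function.Properties.Equivalence using (⇔-setoid)
open import Function.Properties.Inverse using (↔⇒↣)
open import Function.Related.TypeIsomorphisms using (¬-cong-⇔)
open import Level using (0ℓ)
open import Relation.Nullary using (yes; no; contradiction)
open import Relation.Binary.Definitions using (tri<; tri≈; tri>)
open import Relation.Binary.PropositionalEquality as ≡ using (_≡_; refl; _≢_; cong; subst₂)
import Relation.Binary.Reasoning.Setoid as ≈-Reasoning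

open Inverse using (to)

module _ {A : Set} where

  index-∈-++⁺ˡ<index-∈-++⁺ʳ : ∀ {x y : A} xs {ys} (p : x ∈ xs) (q : y ∈ ys) →
    toℕ (index (∈-++⁺ˡ {ys = ys} p)) ℕ.< toℕ (index (∈-++⁺ʳ xs q))
  index-∈-++⁺ˡ<index-∈-++⁺ʳ (_ ∷ _)  (here _)  q = ℕ.s≤s ℕ.z≤n
  index-∈-++⁺ˡ<index-∈-++⁺ʳ (_ ∷ xs) (there p) q = ℕ.s≤s (index-∈-++⁺ˡ<index-∈-++⁺ʳ xs p q)

  split⇒index< : ∀ {x y : A} {w} xs ys → w ≡ xs ++ ys → x ∈ xs → y ∈ ys →
    ∃₂ λ (p : x ∈ w) (q : y ∈ w) → toℕ (index p) ℕ.< toℕ (index q)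
  split⇒index< xs ys refl p q = ∈-++⁺ˡ p , ∈-++⁺ʳ xs q , index-∈-++⁺ˡ<index-∈-++⁺ʳ xs p q

  index<⇒split : ∀ {x y : A} w (p : x ∈ w) (q : y ∈ w) → toℕ (index p) ℕ.< toℕ (index q) →
    ∃₂ λ xs ys → w ≡ xs ++ ys × x ∈ xs × y ∈ ys
  index<⇒split (a ∷ w) (here refl) (there q) _          = a ∷ [] , w , refl , here refl , q
  index<⇒split (a ∷ w) (there p)   (there q) (ℕ.s≤s lt)
    with xs , ys , refl , p′ , q′ ← index<⇒split w p q lt
    = a ∷ xs , ys , refl , there p′ , q′

-- A value k missed by f lets punchOut k squeeze f injectively into a smaller Fin.
injective⇒surjective : ∀ {m n} → n ≤ m → (f : Fin m → Fin n) → Injective _≡_ _≡_ f →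
  ∀ k → ∃ λ i → f i ≡ k
injective⇒surjective {m} {suc n} n<m f f-injective k with any? (λ i → f i ≟ k)
... | yes hit  = hit
... | no ¬hit = contradiction (injective⇒≤ squeeze-injective) (ℕ.<⇒≱ n<m)
  where
  fi≢k : ∀ i → k ≢ f i
  fi≢k i k≡fi = ¬hit (i , ≡.sym k≡fi)

  squeeze : Fin m → Fin n
  squeeze i = punchOut (fi≢k i)

  squeeze-injective : Injective _≡_ _≡_ squeeze
  squeeze-injective {i} {j} eq = f-injective (punchOut-injective (fi≢k i) (fi≢k j) eq)

module ShortCoveringWord {n} (w : List (Fin n)) (covers : ∀ i → i ∈ w) (short : length w ≤ n) where

  position : Fin n → Fin (length w)
  position i = index (covers i)

  lookup-position : ∀ i → lookup w (position i) ≡ i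
  lookup-position i = ≡.sym (lookup-index (covers i))

  position-injective : Injective _≡_ _≡_ position
  position-injective {i} {j} eq = begin
    i                        ≡⟨ lookup-position i ⟨
    lookup w (position i)    ≡⟨ cong (lookup w) eq ⟩
    lookup w (position j)    ≡⟨ lookup-position j ⟩
    j                        ∎
    where open ≡.≡-Reasoning

  position-lookup : ∀ k → position (lookup w k) ≡ k
  position-lookup k with i , refl ← injective⇒surjective short position position-injective k
    = cong position (lookup-position i)

  index≡position : ∀ {i} (p : i ∈ w) → index p ≡ position i
  index≡position p =
    ≡.trans (≡.sym (position-lookup (index p))) (cong position (≡.sym (lookup-index p)))

  length≡n : length w ≡ n
  length≡n = ℕ.≤-antisym short (injective⇒≤ position-injective)

  permutation : Fin n ↔ Fin n
  permutation = mk↔ₛ′ (cast length≡n ∘ position) (lookup w ∘ cast (≡.sym length≡n))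
    (λ k → ≡.trans (cong (cast length≡n) (position-lookup _)) (cast-involutive length≡n _ k))
    (λ i → ≡.trans (cong (lookup w) (cast-involutive _ length≡n (position i))) (lookup-position i))

  toℕ-permutation : ∀ i → toℕ (to permutation i) ≡ toℕ (position i)
  toℕ-permutation i = toℕ-cast length≡n (position i)

  precedes⇔permutation< : ∀ i j → Precedes w i j ⇔ to permutation i < to permutation j
  precedes⇔permutation< i j = mk⇔ precedes⇒< <⇒precedes
    where
    precedes⇒< : Precedes w i j → to permutation i < to permutation j
    precedes⇒< (xs , ys , w≡xs++ys , i∈xs , j∈ys)
      with p , q , lt ← split⇒index< xs ys w≡xs++ys i∈xs j∈ys
      = subst₂ ℕ._<_ (toℕ-index p) (toℕ-index q) lt
      where
      toℕ-index : ∀ {k} (p : k ∈ w) → toℕ (index p) ≡ toℕ (to permutation k)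
      toℕ-index {k} p = ≡.trans (cong toℕ (index≡position p)) (≡.sym (toℕ-permutation k))

    <⇒precedes : to permutation i < to permutation j → Precedes w i j
    <⇒precedes lt = index<⇒split w (covers i) (covers j)
      (subst₂ ℕ._<_ (toℕ-permutation i) (toℕ-permutation j) lt)

⇔InversionAdj : ∀ {n} (π : Fin n ↔ Fin n) {H : Fin n → Fin n → Set} →
  (∀ {i j} → H i j → H j i) → (∀ {i} → ¬ H i i) →
  (∀ i j → i < j → H i j ⇔ to π j < to π i) →
  ∀ i j → H i j ⇔ InversionAdj π i j
⇔InversionAdj π H-sym H-irrefl H⇔inversion i j with <-cmp i j
... | tri< i<j _ _ = mk⇔ (λ h → inj₁ (i<j , Equivalence.to (H⇔inversion i j i<j) h)) λ where
  (inj₁ (_ , πj<πi)) → Equivalence.from (H⇔inversion i j i<j) πj<πi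
  (inj₂ (j<i , _))   → contradiction j<i (<-asym i<j)
... | tri≈ _ refl _ = mk⇔ (λ h → contradiction h H-irrefl) λ where
  (inj₁ (i<i , _)) → contradiction refl (<⇒≢ i<i)
  (inj₂ (i<i , _)) → contradiction refl (<⇒≢ i<i)
... | tri> _ _ j<i = mk⇔ (λ h → inj₂ (j<i , Equivalence.to (H⇔inversion j i j<i) (H-sym h))) λ where
  (inj₂ (_ , πi<πj)) → H-sym (Equivalence.from (H⇔inversion j i j<i) πi<πj)
  (inj₁ (i<j , _))   → contradiction j<i (<-asym i<j)

labeled⇔InversionAdj⇒isPermutationGraph : ∀ {n} (G : Graph n) (σ π : Fin n ↔ Fin n) →
  (∀ i j → labeled G σ i j ⇔ InversionAdj π i j) → IsPermutationGraph G
labeled⇔InversionAdj⇒isPermutationGraph G σ π labeled⇔inversion = σ , π , λ u v →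
  subst₂ (λ x y → Adj G x y ⇔ InversionAdj π (to σ u) (to σ v))
    (Inverse.strictlyInverseʳ σ u) (Inverse.strictlyInverseʳ σ v)
    (labeled⇔inversion (to σ u) (to σ v))

¬<⇔> : ∀ {n} {i j : Fin n} → i ≢ j → (¬ i < j) ⇔ j < i
¬<⇔> {i = i} {j} i≢j = mk⇔ ≮⇒> (λ j<i i<j → <-asym i<j j<i)
  where
  ≮⇒> : ¬ i < j → j < i
  ≮⇒> i≮j with <-cmp i j
  ... | tri< i<j _ _ = contradiction i<j i≮j
  ... | tri≈ _ i≡j _ = contradiction i≡j i≢j
  ... | tri> _ _ j<i = j<i

short-12-representant⇒isPermutationGraph : ∀ {n} (G : Graph n) (σ : Fin n ↔ Fin n) (w : List (Fin n)) →
  Is12Representant (labeled G σ) w → length w ≤ n → IsPermutationGraph G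
short-12-representant⇒isPermutationGraph G σ w (covers , represents) short =
  labeled⇔InversionAdj⇒isPermutationGraph G σ π
    (⇔InversionAdj π (sym G) (irrefl G) labeled⇔inversion)
  where
  open ShortCoveringWord w covers short using (precedes⇔permutation<) renaming (permutation to π)

  labeled⇔inversion : ∀ i j → i < j → labeled G σ i j ⇔ to π j < to π i
  labeled⇔inversion i j i<j = begin
    labeled G σ i j        ≈⟨ represents i j i<j ⟩
    ¬ Precedes w i j       ≈⟨ ¬-cong-⇔ (precedes⇔permutation< i j) ⟩
    (¬ to π i < to π j)    ≈⟨ ¬<⇔> (<⇒≢ i<j ∘ Injection.injective (↔⇒↣ π)) ⟩
    to π j < to π i        ∎
    where open ≈-Reasoning (⇔-setoid 0ℓ)

corollary2p4 : (n : ℕ) (G : Graph n) → ¬ IsPermutationGraph G →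
    (σ : Fin n ↔ Fin n) (w : List (Fin n)) →
    Is12Representant (labeled G σ) w → suc n ≤ length w
corollary2p4 n G not-permutation σ w representant with length w ℕ.≤? n
... | no long   = ℕ.≰⇒> long
... | yes short = contradiction
  (short-12-representant⇒isPermutationGraph G σ w representant short) not-permutation
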